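{- Let $G$ be a connected graph of order $n\ge 2$ and let $H$ be a connected graph with at least two vertices and root vertex $v$. Then $$\gamma_w(G\circ H)\in\{\,n\gamma_w(H),\ n\gamma_w(H)+\gamma_w(G)\,\}.$$
   Context: All graphs are finite, simple and undirected. For a set $D$ of vertices of $G$, the subgraph weakly induced by $D$ is $(N_G[D],E_w)$, where $N_G[D]$ is the union of closed neighborhoods of vertices of $D$ and $E_w$ is the set of edges having at least one end in $D$. A dominating set $D$ (every vertex outside $D$ has a neighbor in $D$) is weakly connected if its weakly induced subgraph is connected; $\gamma_w(G)$ is the minimum cardinality of a weakly connected dominating set. For $G$ with vertex set $\{v_1,\dots,v_n\}$ and $H$ with root $v$, the rooted product $G\circ H$ is obtained from one copy of $G$ and $n$ copies $H_1,\dots,H_n$ of $H$ by identifying each $v_i$ with the copy of $v$ in $H_i$. -}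

module Defs where

open import Data.Nat using (ℕ; _≤_)
open import Data.Fin using (Fin; remQuot)
open import Data.Fin.Subset using (Subset; _∈_; _∉_; ∣_∣)
open import Data.Product using (Σ; ∃; ∃-syntax; _×_; _,_; proj₁; proj₂)
open import Data.Sum using (_⊎_)
open import Relation.Binary.PropositionalEquality using (_≡_)
open import Relation.Nullary using (¬_; Dec; yes; no)
open import Relation.Nullary.Decidable using (_×-dec_; _⊎-dec_)
open import Data.Fin using (_≟_)
open import Data.Nat using (_*_)
import Relation.Binary.PropositionalEquality as Eq
open import Data.Sum using (inj₁; inj₂)

record Graph (n : ℕ) : Set₁ where
  field
    Adj   : Fin n → Fin n → Set
    adj?  : ∀ x y → Dec (Adj x y)
    sym   : ∀ {x y} → Adj x y → Adj y x
    irrefl : ∀ {x} → ¬ Adj x x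
open Graph public

data WalkVia {n : ℕ} (G : Graph n) (P : Fin n → Fin n → Set) : Fin n → Fin n → Set where
  here : ∀ {x} → WalkVia G P x x
  step : ∀ {x y z} → Adj G x y → P x y → WalkVia G P y z → WalkVia G P x z

Connected : ∀ {n} → Graph n → Set
Connected G = ∀ x y → WalkVia G (λ _ _ → Data.Unit.⊤) x y
  where import Data.Unit

InClosedNbhd : ∀ {n} → Graph n → Subset n → Fin n → Set
InClosedNbhd G D x = x ∈ D ⊎ ∃[ d ] (d ∈ D × Adj G x d)

Dominating : ∀ {n} → Graph n → Subset n → Set
Dominating G D = ∀ x → x ∉ D → ∃[ d ] (d ∈ D × Adj G x d)

-- The subgraph weakly induced by D, (N[D], E_w), is connected:
-- any two vertices of N[D] are joined by a walk all of whose edges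
-- have at least one end in D (such walks stay inside N[D]).
WeaklyConnected : ∀ {n} → Graph n → Subset n → Set
WeaklyConnected G D =
  ∀ x y → InClosedNbhd G D x → InClosedNbhd G D y →
    WalkVia G (λ a b → a ∈ D ⊎ b ∈ D) x y

IsWCDS : ∀ {n} → Graph n → Subset n → Set
IsWCDS G D = Dominating G D × WeaklyConnected G D

IsGammaW : ∀ {n} → Graph n → ℕ → Set
IsGammaW G k = (∃[ D ] (IsWCDS G D × ∣ D ∣ ≡ k)) × (∀ D → IsWCDS G D → k ≤ ∣ D ∣)

-- Rooted product G ∘ H with root r of H. Vertex (i , a) (encoded as an
-- element of Fin (n * m) via remQuot) is vertex a of the i-th copy H_i;
-- vertex v_i of G is identified with (i , r).
rootedAdj : ∀ {n m} → Graph n → Graph m → Fin m → Fin n × Fin m → Fin n × Fin m → Set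
rootedAdj G H r (i , a) (j , b) =
  (i ≡ j × Adj H a b) ⊎ (a ≡ r × b ≡ r × Adj G i j)

module _ {n m : ℕ} (G : Graph n) (H : Graph m) (r : Fin m) where
  private
    RA = rootedAdj G H r

    ra? : ∀ x y → Dec (RA x y)
    ra? (i , a) (j , b) = ((i ≟ j) ×-dec adj? H a b) ⊎-dec ((a ≟ r) ×-dec ((b ≟ r) ×-dec adj? G i j))

    ra-sym : ∀ {x y} → RA x y → RA y x
    ra-sym (inj₁ (e , h)) = inj₁ (Eq.sym e , Graph.sym H h)
    ra-sym (inj₂ (ea , eb , g)) = inj₂ (eb , ea , Graph.sym G g)

    ra-irr : ∀ {x} → ¬ RA x x
    ra-irr (inj₁ (_ , h)) = irrefl H h
    ra-irr (inj₂ (_ , _ , g)) = irrefl G g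

  rootedProduct : Graph (n * m)
  rootedProduct = record
    { Adj = λ x y → RA (remQuot m x) (remQuot m y)
    ; adj? = λ x y → ra? (remQuot m x) (remQuot m y)
    ; sym = ra-sym
    ; irrefl = ra-irr
    }

module Submission where

-- Say E "links" a graph K if any two vertices are joined by a walk whose
-- edges all have an end in E; on ≥ 2 vertices the linking sets are exactly
-- the weakly connected dominating sets.  A vertex set of G ∘ H is a family
-- of "blocks" B i ⊆ V(H_i); let roots B be the i with the root in B i.
-- Projecting and lifting walks shows: the blocks link G ∘ H iff every B i
-- links H and roots B links G.  So an optimal set has |B i| ≥ γ_w(H) for
-- all i and |roots B| ≥ γ_w(G).  If some B i contains the root and has
-- γ_w(H) vertices, n copies of it link G ∘ H (G is connected); otherwise
-- each block containing the root costs one more, giving ≥ n·γ_w(H)+γ_w(G),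
-- which is attained by optimal sets of H in all copies plus the roots of an
-- optimal set of G.

open import Defs
open import Data.Nat using (ℕ; _≤_; _*_; _+_)
open import Data.Fin using (Fin)
open import Data.Sum using (_⊎_)
open import Relation.Binary.PropositionalEquality using (_≡_)

open import Data.Empty using (⊥-elim)
open import Data.Bool using (Bool; true; false)
open import Data.Fin using (zero; suc; combine; remQuot; punchIn)
import Data.Fin.Properties as Finₚ
open import Data.Fin.Subset using (Subset; _∈_; _∉_; _⊆_; _∪_; ⁅_⁆; ⊤; ∣_∣)
open import Data.Fin.Subset.Properties
  using (_∈?_; ∈⊤; x∈⁅x⁆; ∣⁅x⁆∣≡1; ∣p∣≤∣x∷p∣; p⊆p∪q; x∈p∪q⁺)
open import Data.Nat using (zero; suc; z≤n; s≤s)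
import Data.Nat.Properties as ℕₚ
open import Data.Product using (∃-syntax; _×_; _,_; proj₁; proj₂)
open import Data.Sum using (inj₁; inj₂) renaming (map to ⊎-map)
open import Data.Vec using (Vec; []; _∷_; _++_; concat; lookup; tabulate)
open import Data.Vec.Properties
  using (lookup-concat; lookup∘tabulate; tabulate∘lookup; tabulate-cong; lookup⇒[]=; []=⇒lookup)
open import Function using (id; _∘_)
open import Relation.Binary.PropositionalEquality
  using (_≢_; refl; trans; cong; cong₂; subst; subst₂; module ≡-Reasoning)
  renaming (sym to ≡-sym)
open import Relation.Nullary using (yes; no; ¬_)
open import Relation.Nullary.Decidable using (_×-dec_)

open import Algebra.Properties.CommutativeMonoid.Sum ℕₚ.+-0-commutativeMonoid
  using (sum-syntax; ∑-distrib-+; sum-cong-≗)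

∑-mono : ∀ {k} {f g : Fin k → ℕ} → (∀ i → f i ≤ g i) → ∑[ i < k ] f i ≤ ∑[ i < k ] g i
∑-mono {zero}  f≤g = z≤n
∑-mono {suc k} f≤g = ℕₚ.+-mono-≤ (f≤g zero) (∑-mono (f≤g ∘ suc))

∑-const : ∀ k c → ∑[ i < k ] c ≡ k * c
∑-const zero    c = refl
∑-const (suc k) c = cong (c +_) (∑-const k c)

indicator : Bool → ℕ
indicator true  = 1
indicator false = 0

∑-const-+ : ∀ k c (b : Fin k → Bool) →
  ∑[ i < k ] (c + indicator (b i)) ≡ k * c + ∑[ i < k ] indicator (b i)
∑-const-+ k c b = trans (∑-distrib-+ (λ _ → c) (indicator ∘ b)) (cong (_+ _) (∑-const k c))

∣p∣≡∑ : ∀ {k} (p : Subset k) → ∣ p ∣ ≡ ∑[ i < k ] indicator (lookup p i)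
∣p∣≡∑ []          = refl
∣p∣≡∑ (true ∷ p)  = cong suc (∣p∣≡∑ p)
∣p∣≡∑ (false ∷ p) = ∣p∣≡∑ p

∣p++q∣ : ∀ {k l} (p : Subset k) (q : Subset l) → ∣ p ++ q ∣ ≡ ∣ p ∣ + ∣ q ∣
∣p++q∣ []          q = refl
∣p++q∣ (true ∷ p)  q = cong suc (∣p++q∣ p q)
∣p++q∣ (false ∷ p) q = ∣p++q∣ p q

∣concat∣ : ∀ {k l} (ps : Vec (Subset l) k) → ∣ concat ps ∣ ≡ ∑[ i < k ] ∣ lookup ps i ∣
∣concat∣ []       = refl
∣concat∣ (p ∷ ps) = trans (∣p++q∣ p (concat ps)) (cong (∣ p ∣ +_) (∣concat∣ ps))

∣p∪q∣≤∣p∣+∣q∣ : ∀ {k} (p q : Subset k) → ∣ p ∪ q ∣ ≤ ∣ p ∣ + ∣ q ∣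
∣p∪q∣≤∣p∣+∣q∣ []          []          = z≤n
∣p∪q∣≤∣p∣+∣q∣ (true ∷ p)  (y ∷ q)     =
  s≤s (ℕₚ.≤-trans (∣p∪q∣≤∣p∣+∣q∣ p q) (ℕₚ.+-monoʳ-≤ ∣ p ∣ (∣p∣≤∣x∷p∣ y q)))
∣p∪q∣≤∣p∣+∣q∣ (false ∷ p) (true ∷ q)  =
  ℕₚ.≤-trans (s≤s (∣p∪q∣≤∣p∣+∣q∣ p q)) (ℕₚ.≤-reflexive (≡-sym (ℕₚ.+-suc ∣ p ∣ ∣ q ∣)))
∣p∪q∣≤∣p∣+∣q∣ (false ∷ p) (false ∷ q) = ∣p∪q∣≤∣p∣+∣q∣ p q

addIf : ∀ {k} → Bool → Fin k → Subset k → Subset k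
addIf true  x E = E ∪ ⁅ x ⁆
addIf false x E = E

⊆addIf : ∀ {k} b (x : Fin k) E → E ⊆ addIf b x E
⊆addIf true  x E = p⊆p∪q ⁅ x ⁆
⊆addIf false x E = id

∈addIf : ∀ {k} (x : Fin k) E → x ∈ addIf true x E
∈addIf x E = x∈p∪q⁺ (inj₂ (x∈⁅x⁆ x))

∣addIf∣ : ∀ {k} b (x : Fin k) E → ∣ addIf b x E ∣ ≤ ∣ E ∣ + indicator b
∣addIf∣ true  x E =
  ℕₚ.≤-trans (∣p∪q∣≤∣p∣+∣q∣ E ⁅ x ⁆) (ℕₚ.≤-reflexive (cong (∣ E ∣ +_) (∣⁅x⁆∣≡1 x)))
∣addIf∣ false x E = ℕₚ.≤-reflexive (≡-sym (ℕₚ.+-identityʳ ∣ E ∣))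

-- Walks and linking sets in a general graph

infixr 5 _++ʷ_
_++ʷ_ : ∀ {k} {K : Graph k} {Q : Fin k → Fin k → Set} {x y z} →
  WalkVia K Q x y → WalkVia K Q y z → WalkVia K Q x z
here         ++ʷ w′ = w′
step e q w   ++ʷ w′ = step e q (w ++ʷ w′)

walk-map : ∀ {k l} {K : Graph k} {L : Graph l}
  {Q : Fin k → Fin k → Set} {R : Fin l → Fin l → Set} (f : Fin k → Fin l) →
  (∀ {x z} → Adj K x z → Q x z → WalkVia L R (f x) (f z)) →
  ∀ {x y} → WalkVia K Q x y → WalkVia L R (f x) (f y)
walk-map f edge here         = here
walk-map f edge (step e q w) = edge e q ++ʷ walk-map f edge w

another : ∀ {k} → 2 ≤ k → (x : Fin k) → ∃[ y ] (y ≢ x)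
another (s≤s (s≤s _)) x = punchIn x zero , Finₚ.punchInᵢ≢i x zero

module _ {k : ℕ} (K : Graph k) where

  EndIn : Subset k → Fin k → Fin k → Set
  EndIn E u v = u ∈ E ⊎ v ∈ E

  Links : Subset k → Set
  Links E = ∀ x y → WalkVia K (EndIn E) x y

  links-mono : ∀ {E F} → E ⊆ F → Links E → Links F
  links-mono E⊆F L x y = walk-map id (λ e end → step e (⊎-map E⊆F E⊆F end) here) (L x y)

  connected⇒links⊤ : Connected K → Links ⊤
  connected⇒links⊤ c x y = walk-map id (λ e _ → step e (inj₁ ∈⊤) here) (c x y)

  first-neighbour : ∀ {E x y} → WalkVia K (EndIn E) x y → x ≢ y → x ∉ E →
    ∃[ d ] (d ∈ E × Adj K x d)
  first-neighbour here                   x≢x _   = ⊥-elim (x≢x refl)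
  first-neighbour (step e (inj₁ x∈E) _) _   x∉E = ⊥-elim (x∉E x∈E)
  first-neighbour (step e (inj₂ d∈E) _) _   _   = _ , d∈E , e

  -- Weakly connected dominating sets link: domination puts every vertex in N[E].
  wcds⇒links : ∀ {E} → IsWCDS K E → Links E
  wcds⇒links {E} (dom , wc) x y = wc x y (closed x) (closed y)
    where
    closed : ∀ v → InClosedNbhd K E v
    closed v with v ∈? E
    ... | yes v∈E = inj₁ v∈E
    ... | no  v∉E = inj₂ (dom v v∉E)

  links⇒wcds : ∀ {E} → 2 ≤ k → Links E → IsWCDS K E
  links⇒wcds 2≤k L = dominating , λ x y _ _ → L x y
    where
    dominating : Dominating K _
    dominating x x∉E =
      let y , y≢x = another 2≤k x in first-neighbour (L x y) (y≢x ∘ ≡-sym) x∉E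

  γ-lower : ∀ {g E} → IsGammaW K g → 2 ≤ k → Links E → g ≤ ∣ E ∣
  γ-lower (_ , minimal) 2≤k L = minimal _ (links⇒wcds 2≤k L)

-- Block structure of the rooted product

module RootedProduct {n m : ℕ} (G : Graph n) (H : Graph m) (r : Fin m) where

  P : Graph (n * m)
  P = rootedProduct G H r

  RAdj : Fin n × Fin m → Fin n × Fin m → Set
  RAdj = rootedAdj G H r

  coords : Fin (n * m) → Fin n × Fin m
  coords = remQuot m

  coords-combine : ∀ i a → coords (combine i a) ≡ (i , a)
  coords-combine = Finₚ.remQuot-combine

  combine-coords : ∀ x → combine (proj₁ (coords x)) (proj₂ (coords x)) ≡ x
  combine-coords = Finₚ.combine-remQuot {n} m

  adj-combine : ∀ {i a j b} → RAdj (i , a) (j , b) → Adj P (combine i a) (combine j b)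
  adj-combine = subst₂ RAdj (≡-sym (coords-combine _ _)) (≡-sym (coords-combine _ _))

  blocks : (Fin n → Subset m) → Subset (n * m)
  blocks B = concat (tabulate B)

  rows : Subset (n * m) → Fin n → Subset m
  rows D i = tabulate (λ a → lookup D (combine i a))

  roots : (Fin n → Subset m) → Subset n
  roots B = tabulate (λ i → lookup (B i) r)

  InBlock : (Fin n → Subset m) → Fin n × Fin m → Set
  InBlock B p = proj₂ p ∈ B (proj₁ p)

  lookup-blocks : ∀ B i a → lookup (blocks B) (combine i a) ≡ lookup (B i) a
  lookup-blocks B i a =
    trans (lookup-concat (tabulate B) i a) (cong (λ p → lookup p a) (lookup∘tabulate B i))

  blocks-rows : ∀ D → blocks (rows D) ≡ D
  blocks-rows D =
    trans (≡-sym (tabulate∘lookup _)) (trans (tabulate-cong same-entry) (tabulate∘lookup D))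
    where
    open ≡-Reasoning
    same-entry : ∀ x → lookup (blocks (rows D)) x ≡ lookup D x
    same-entry x = let (i , a) = coords x in begin
      lookup (blocks (rows D)) x              ≡⟨ cong (lookup (blocks (rows D))) (≡-sym (combine-coords x)) ⟩
      lookup (blocks (rows D)) (combine i a)  ≡⟨ lookup-blocks (rows D) i a ⟩
      lookup (rows D i) a                     ≡⟨ lookup∘tabulate _ a ⟩
      lookup D (combine i a)                  ≡⟨ cong (lookup D) (combine-coords x) ⟩
      lookup D x                              ∎

  ∈blocks⁺ : ∀ {B i a} → a ∈ B i → combine i a ∈ blocks B
  ∈blocks⁺ {B} {i} {a} a∈Bi =
    lookup⇒[]= _ (blocks B) (trans (lookup-blocks B i a) ([]=⇒lookup a∈Bi))

  ∈blocks⁻ : ∀ {B} x → x ∈ blocks B → InBlock B (coords x)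
  ∈blocks⁻ {B} x x∈D = let (i , a) = coords x in lookup⇒[]= a (B i) (begin
      lookup (B i) a                          ≡⟨ lookup-blocks B i a ⟨
      lookup (blocks B) (combine i a)         ≡⟨ cong (lookup (blocks B)) (combine-coords x) ⟩
      lookup (blocks B) x                     ≡⟨ []=⇒lookup x∈D ⟩
      true                                    ∎)
    where open ≡-Reasoning

  ∈roots⁺ : ∀ {B i} → r ∈ B i → i ∈ roots B
  ∈roots⁺ {B} {i} r∈Bi = lookup⇒[]= i (roots B) (trans (lookup∘tabulate _ i) ([]=⇒lookup r∈Bi))

  ∈roots⁻ : ∀ {B i} → i ∈ roots B → r ∈ B i
  ∈roots⁻ {B} {i} i∈S = lookup⇒[]= r (B i) (trans (≡-sym (lookup∘tabulate _ i)) ([]=⇒lookup i∈S))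

  ∣blocks∣ : ∀ B → ∣ blocks B ∣ ≡ ∑[ i < n ] ∣ B i ∣
  ∣blocks∣ B = trans (∣concat∣ (tabulate B)) (sum-cong-≗ (cong ∣_∣ ∘ lookup∘tabulate B))

  ∣roots∣ : ∀ B → ∣ roots B ∣ ≡ ∑[ i < n ] indicator (lookup (B i) r)
  ∣roots∣ B = trans (∣p∣≡∑ (roots B))
    (sum-cong-≗ (cong indicator ∘ lookup∘tabulate (λ i → lookup (B i) r)))

  -- Projection onto the copy H_i: vertices of other copies go to the root,
  -- which is where those copies are attached.
  toCopy : Fin n → Fin n × Fin m → Fin m
  toCopy i (j , a) with j Finₚ.≟ i
  ... | yes _ = a
  ... | no  _ = r

  toCopy-own : ∀ i a → toCopy i (i , a) ≡ a
  toCopy-own i a with i Finₚ.≟ i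
  ... | yes _   = refl
  ... | no  i≢i = ⊥-elim (i≢i refl)

  toCopy-root : ∀ i j → toCopy i (j , r) ≡ r
  toCopy-root i j with j Finₚ.≟ i
  ... | yes _ = refl
  ... | no  _ = refl

  -- An edge of G ∘ H with an end in blocks B projects to a (possibly
  -- empty) walk of B i-edges in H: edges of H_i stay, all others collapse.
  copy-edge : ∀ B i {p q} → RAdj p q → InBlock B p ⊎ InBlock B q →
    WalkVia H (EndIn H (B i)) (toCopy i p) (toCopy i q)
  copy-edge B i {j , a} {_ , b} (inj₁ (refl , a~b)) end with j Finₚ.≟ i
  ... | yes refl = step a~b end here
  ... | no  _    = here
  copy-edge B i {j , _} {j′ , _} (inj₂ (refl , refl , _)) _ =
    subst₂ (WalkVia H _) (≡-sym (toCopy-root i j)) (≡-sym (toCopy-root i j′)) here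

  -- An edge of G ∘ H with an end in blocks B projects to G as a (possibly
  -- empty) walk of roots B-edges: only edges between roots survive.
  root-edge : ∀ B {p q} → RAdj p q → InBlock B p ⊎ InBlock B q →
    WalkVia G (EndIn G (roots B)) (proj₁ p) (proj₁ q)
  root-edge B {_ , _} {_ , _} (inj₁ (refl , _))        _   = here
  root-edge B {_ , _} {_ , _} (inj₂ (refl , refl , g)) end =
    step g (⊎-map (∈roots⁺ {B}) (∈roots⁺ {B}) end) here

  links-rows : ∀ B → Links P (blocks B) → ∀ i → Links H (B i)
  links-rows B L i a b =
    subst₂ (WalkVia H _) (own a) (own b)
      (walk-map (toCopy i ∘ coords) edge (L (combine i a) (combine i b)))
    where
    edge : ∀ {x z} → Adj P x z → EndIn P (blocks B) x z →
      WalkVia H (EndIn H (B i)) (toCopy i (coords x)) (toCopy i (coords z))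
    edge e end = copy-edge B i e (⊎-map (∈blocks⁻ _) (∈blocks⁻ _) end)
    own : ∀ a → toCopy i (coords (combine i a)) ≡ a
    own a = trans (cong (toCopy i) (coords-combine i a)) (toCopy-own i a)

  links-roots : ∀ B → Links P (blocks B) → Links G (roots B)
  links-roots B L i j =
    subst₂ (WalkVia G _) (copy i) (copy j)
      (walk-map (proj₁ ∘ coords) edge (L (combine i r) (combine j r)))
    where
    edge : ∀ {x z} → Adj P x z → EndIn P (blocks B) x z →
      WalkVia G (EndIn G (roots B)) (proj₁ (coords x)) (proj₁ (coords z))
    edge e end = root-edge B e (⊎-map (∈blocks⁻ _) (∈blocks⁻ _) end)
    copy : ∀ i → proj₁ (coords (combine i r)) ≡ i
    copy i = cong proj₁ (coords-combine i r)

  -- Conversely, if every B i links H and roots B links G, then blocks B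
  -- links G ∘ H: go to the root of the own copy, along G, then out again.
  links-blocks : ∀ B → (∀ i → Links H (B i)) → Links G (roots B) → Links P (blocks B)
  links-blocks B LH LG x y =
    subst₂ (WalkVia P _) (combine-coords x) (combine-coords y)
      (in-copy (LH _ _ r) ++ʷ along-roots (LG _ _) ++ʷ in-copy (LH _ r _))
    where
    in-copy : ∀ {i a b} → WalkVia H (EndIn H (B i)) a b →
      WalkVia P (EndIn P (blocks B)) (combine i a) (combine i b)
    in-copy = walk-map _ (λ a~b end →
      step (adj-combine (inj₁ (refl , a~b))) (⊎-map ∈blocks⁺ ∈blocks⁺ end) here)
    along-roots : ∀ {i j} → WalkVia G (EndIn G (roots B)) i j →
      WalkVia P (EndIn P (blocks B)) (combine i r) (combine j r)
    along-roots = walk-map (λ i → combine i r) (λ i~j end →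
      step (adj-combine (inj₂ (refl , refl , i~j)))
        (⊎-map (∈blocks⁺ ∘ ∈roots⁻ {B}) (∈blocks⁺ ∘ ∈roots⁻ {B}) end) here)

-- The four estimates

module Estimates {n m : ℕ} (G : Graph n) (H : Graph m) (r : Fin m)
  (2≤n : 2 ≤ n) (2≤m : 2 ≤ m) {gG gH gGH : ℕ}
  (γG : IsGammaW G gG) (γH : IsGammaW H gH) (γP : IsGammaW (rootedProduct G H r) gGH) where

  open RootedProduct G H r

  2≤nm : 2 ≤ n * m
  2≤nm = ℕₚ.*-mono-≤ 2≤n (ℕₚ.≤-trans (s≤s z≤n) 2≤m)

  upper : ∀ B → (∀ i → Links H (B i)) → Links G (roots B) → gGH ≤ ∑[ i < n ] ∣ B i ∣
  upper B LH LG =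
    ℕₚ.≤-trans (γ-lower P γP 2≤nm (links-blocks B LH LG)) (ℕₚ.≤-reflexive (∣blocks∣ B))

  optimal : Subset (n * m)
  optimal = proj₁ (proj₁ γP)

  B : Fin n → Subset m
  B = rows optimal

  B-links : Links P (blocks B)
  B-links =
    subst (Links P) (≡-sym (blocks-rows optimal)) (wcds⇒links P (proj₁ (proj₂ (proj₁ γP))))

  gGH≡∑ : gGH ≡ ∑[ i < n ] ∣ B i ∣
  gGH≡∑ = trans (≡-sym (proj₂ (proj₂ (proj₁ γP))))
            (trans (cong ∣_∣ (≡-sym (blocks-rows optimal))) (∣blocks∣ B))

  row-bound : ∀ i → gH ≤ ∣ B i ∣
  row-bound i = γ-lower H γH 2≤m (links-rows B B-links i)

  TightRow : Fin n → Set
  TightRow i = r ∈ B i × ∣ B i ∣ ≡ gH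

  lower : n * gH ≤ gGH
  lower = ℕₚ.≤-trans (ℕₚ.≤-reflexive (≡-sym (∑-const n gH)))
            (ℕₚ.≤-trans (∑-mono row-bound) (ℕₚ.≤-reflexive (≡-sym gGH≡∑)))

  -- Copying a tight row into every copy links G ∘ H, since G is connected.
  upper-tight : Connected G → ∀ {i} → TightRow i → gGH ≤ n * gH
  upper-tight cG {i} (r∈Bi , ∣Bi∣≡gH) = begin
    gGH                    ≤⟨ upper (λ _ → B i) (λ _ → links-rows B B-links i)
                                (links-mono G (λ _ → ∈roots⁺ r∈Bi) (connected⇒links⊤ G cG)) ⟩
    ∑[ j < n ] ∣ B i ∣     ≡⟨ ∑-const n _ ⟩
    n * ∣ B i ∣            ≡⟨ cong (n *_) ∣Bi∣≡gH ⟩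
    n * gH                 ∎
    where open ℕₚ.≤-Reasoning

  -- Without tight rows, every row containing the root pays one extra vertex.
  lower-slack : ¬ (∃[ i ] TightRow i) → n * gH + gG ≤ gGH
  lower-slack no-tight = begin
    n * gH + gG                                        ≤⟨ ℕₚ.+-monoʳ-≤ (n * gH) root-bound ⟩
    n * gH + ∣ roots B ∣                               ≡⟨ cong (n * gH +_) (∣roots∣ B) ⟩
    n * gH + ∑[ i < n ] indicator (lookup (B i) r)     ≡⟨ ∑-const-+ n gH _ ⟨
    ∑[ i < n ] (gH + indicator (lookup (B i) r))       ≤⟨ ∑-mono row-bound⁺ ⟩
    ∑[ i < n ] ∣ B i ∣                                 ≡⟨ gGH≡∑ ⟨
    gGH                                                ∎
    where
    open ℕₚ.≤-Reasoning
    root-bound : gG ≤ ∣ roots B ∣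
    root-bound = γ-lower G γG 2≤n (links-roots B B-links)
    row-bound⁺ : ∀ i → gH + indicator (lookup (B i) r) ≤ ∣ B i ∣
    row-bound⁺ i with lookup (B i) r in r∈?Bi
    ... | false = ℕₚ.≤-trans (ℕₚ.≤-reflexive (ℕₚ.+-identityʳ gH)) (row-bound i)
    ... | true  = ℕₚ.≤-trans (ℕₚ.≤-reflexive (ℕₚ.+-comm gH 1))
        (ℕₚ.≤∧≢⇒< (row-bound i) (λ gH≡ → no-tight (i , lookup⇒[]= r (B i) r∈?Bi , ≡-sym gH≡)))

  -- An optimal set of H in every copy, plus the roots of an optimal set of G.
  upper-general : gGH ≤ n * gH + gG
  upper-general = begin
    gGH                                            ≤⟨ upper B′ rows-link roots-link ⟩
    ∑[ i < n ] ∣ B′ i ∣                            ≤⟨ ∑-mono (λ i → ∣addIf∣ (lookup S i) r E) ⟩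
    ∑[ i < n ] (∣ E ∣ + indicator (lookup S i))    ≡⟨ ∑-const-+ n ∣ E ∣ _ ⟩
    n * ∣ E ∣ + ∑[ i < n ] indicator (lookup S i)  ≡⟨ cong₂ (λ e s → n * e + s) ∣E∣≡gH (≡-sym (∣p∣≡∑ S)) ⟩
    n * gH + ∣ S ∣                                 ≡⟨ cong (n * gH +_) ∣S∣≡gG ⟩
    n * gH + gG                                    ∎
    where
    open ℕₚ.≤-Reasoning
    E : Subset m
    E = proj₁ (proj₁ γH)
    ∣E∣≡gH : ∣ E ∣ ≡ gH
    ∣E∣≡gH = proj₂ (proj₂ (proj₁ γH))
    S : Subset n
    S = proj₁ (proj₁ γG)
    ∣S∣≡gG : ∣ S ∣ ≡ gG
    ∣S∣≡gG = proj₂ (proj₂ (proj₁ γG))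
    B′ : Fin n → Subset m
    B′ i = addIf (lookup S i) r E
    rows-link : ∀ i → Links H (B′ i)
    rows-link i = links-mono H (⊆addIf (lookup S i) r E) (wcds⇒links H (proj₁ (proj₂ (proj₁ γH))))
    S⊆roots : S ⊆ roots B′
    S⊆roots i∈S =
      ∈roots⁺ {B′} (subst (λ b → r ∈ addIf b r E) (≡-sym ([]=⇒lookup i∈S)) (∈addIf r E))
    roots-link : Links G (roots B′)
    roots-link = links-mono G S⊆roots (wcds⇒links G (proj₁ (proj₂ (proj₁ γG))))

-- Either some optimal row is tight, or
-- none is; the matching pair of estimates then pins γ_w(G ∘ H) down.
mainTheorem11 : ∀ {n m : ℕ} (G : Graph n) (H : Graph m) (r : Fin m) →
    2 ≤ n → Connected G → 2 ≤ m → Connected H →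
    ∀ (gG gH gGH : ℕ) → IsGammaW G gG → IsGammaW H gH →
    IsGammaW (rootedProduct G H r) gGH →
    (gGH ≡ n * gH) ⊎ (gGH ≡ n * gH + gG)
mainTheorem11 {n} G H r 2≤n cG 2≤m _ gG gH gGH γG γH γP = dichotomy
  where
  open Estimates G H r 2≤n 2≤m γG γH γP
  dichotomy : (gGH ≡ n * gH) ⊎ (gGH ≡ n * gH + gG)
  dichotomy with Finₚ.any? (λ i → (r ∈? B i) ×-dec (∣ B i ∣ ℕₚ.≟ gH))
  ... | yes (_ , tight) = inj₁ (ℕₚ.≤-antisym (upper-tight cG tight) lower)
  ... | no  no-tight    = inj₂ (ℕₚ.≤-antisym upper-general (lower-slack no-tight))
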